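{- For any $n$, there exists a graphic matroid $M$ with $n$ elements and a total ordering $\mathcal{O}$ of its elements such that the convex hull of the indicator vectors (in $\mathbb{R}^n$) of all NBC bases of $M$ has an edge of $\ell_2$ length at least $\Omega(\sqrt{n})$.
   Context: A graphic matroid is defined on the edge set of a graph, with independent sets the forests; its circuits are the cycles. Given a total ordering $\mathcal{O}$ of the elements, a broken circuit is a set $C\setminus\{e\}$ with $C$ a circuit and $e$ the smallest element of $C$ under $\mathcal{O}$. An NBC basis is a basis (maximal independent set) containing no broken circuit. An edge of a polytope is a one-dimensional face. -}

module Defs where

open import Data.Nat using (ℕ; zero; suc; _<_)
open import Data.Bool using (Bool; true; false; if_then_else_)
open import Data.Fin using (Fin; zero; suc; inject₁; fromℕ)
open import Data.Fin.Subset using (Subset; _∈_; _⊆_; _-_)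
open import Data.Vec using ([]; _∷_)
open import Data.Product using (Σ; ∃; _×_; _,_)
open import Data.Sum using (_⊎_)
open import Data.Rational as ℚ using (ℚ; 0ℚ)
open import Function using (_∘_; _⇔_)
open import Function.Definitions using (Injective)
open import Relation.Binary.PropositionalEquality using (_≡_; _≢_)
open import Relation.Nullary using (¬_)

-- A (multi)graph with m vertices (Fin m) and n edges (Fin n);
-- edge e has endpoints ends e (loops and parallel edges allowed).
record Graph (m n : ℕ) : Set where
  field
    ends : Fin n → Fin m × Fin m
open Graph public

Joins : ∀ {m n} → Graph m n → Fin n → Fin m → Fin m → Set
Joins G e a b = (ends G e ≡ (a , b)) ⊎ (ends G e ≡ (b , a))

record Cycle {m n} (G : Graph m n) (k : ℕ) : Set where
  field
    vs    : Fin (suc k) → Fin m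
    es    : Fin (suc k) → Fin n
    vs-inj : Injective _≡_ _≡_ vs
    es-inj : Injective _≡_ _≡_ es
    step  : ∀ (i : Fin k) → Joins G (es (inject₁ i)) (vs (inject₁ i)) (vs (suc i))
    close : Joins G (es (fromℕ k)) (vs (fromℕ k)) (vs zero)

IsCircuit : ∀ {m n} → Graph m n → Subset n → Set
IsCircuit {n = n} G C =
  Σ ℕ λ k → Σ (Cycle G k) λ cyc →
    ∀ (e : Fin n) → (e ∈ C) ⇔ (∃ λ i → Cycle.es cyc i ≡ e)

Independent : ∀ {m n} → Graph m n → Subset n → Set
Independent {n = n} G F = ∀ (C : Subset n) → IsCircuit G C → ¬ (C ⊆ F)

IsBasis : ∀ {m n} → Graph m n → Subset n → Set
IsBasis {n = n} G B =
  Independent G B × (∀ (F : Subset n) → B ⊆ F → Independent G F → F ≡ B)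

record Ordering (n : ℕ) : Set where
  field
    rank     : Fin n → ℕ
    rank-inj : Injective _≡_ _≡_ rank
open Ordering public

IsBrokenCircuit : ∀ {m n} → Graph m n → Ordering n → Subset n → Set
IsBrokenCircuit {n = n} G O D =
  Σ (Subset n) λ C → Σ (Fin n) λ e →
    IsCircuit G C × e ∈ C × (∀ f → f ∈ C → f ≢ e → rank O e < rank O f) ×
    D ≡ C - e

IsNBCBasis : ∀ {m n} → Graph m n → Ordering n → Subset n → Set
IsNBCBasis {n = n} G O B =
  IsBasis G B × (∀ (D : Subset n) → IsBrokenCircuit G O D → ¬ (D ⊆ B))

-- c · 1_u  (inner product of c with the indicator vector of u)
dot : ∀ {n} → (Fin n → ℚ) → Subset n → ℚ
dot {zero}  c []      = 0ℚ
dot {suc n} c (b ∷ u) = (if b then c zero else 0ℚ) ℚ.+ dot (c ∘ suc) u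

-- squared ℓ₂ distance between indicator vectors = Hamming distance
hamming : ∀ {n} → Subset n → Subset n → ℕ
hamming []      []      = 0
hamming (true ∷ u)  (false ∷ v) = suc (hamming u v)
hamming (false ∷ u) (true ∷ v)  = suc (hamming u v)
hamming (true ∷ u)  (true ∷ v)  = hamming u v
hamming (false ∷ u) (false ∷ v) = hamming u v

-- For a finite set S ⊆ {0,1}^n of points (given by predicate P), the
-- segment [1_u,1_v] is an edge of conv(S): u ≠ v are in S and some linear
-- functional c attains its maximum over S exactly at u and v
-- (the face of conv S cut out by c is conv{u,v}, which is 1-dimensional).
IsEdgeOfHull : ∀ {n} → (Subset n → Set) → Subset n → Subset n → Set
IsEdgeOfHull {n} P u v =
  P u × P v × u ≢ v ×
  Σ (Fin n → ℚ) λ c → dot c u ≡ dot c v ×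
    (∀ w → P w → w ≢ u → w ≢ v → dot c w ℚ.< dot c u)

{-# OPTIONS --safe #-}
module Submission where

-- Take vertices a₀ … a_{d+1}, b₁ … b_{d+1} (d ≥ 1) and edges spine i = a_i a_{i+1},
-- rung i = a_{i+1} b_{i+1}, diag i = a_i b_{i+1} (i ≤ d), chord i = a_i b_{i+2} (i < d) and
-- r ≤ 3 parallel copies of chord 0, ordered rungs < chords, pads < spines < diagonals; so n = 4d + 3 + r.
-- The spanning trees u = rungs ∪ spines and v = rungs ∪ diagonals are NBC bases at Hamming
-- distance 2d + 2 ≥ n/3.  Chord i is the least edge of the triangle {spine i, diag (i+1), chord i},
-- so no NBC basis contains both spine i and diag (i+1).  Hence, weighting diag 0 by 1, rungs by 4,
-- spine i and diag (i+1) by 2 (i < d) and spine d by 1, every NBC basis weighs at most 6d + 5,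
-- the weight of u and of v.  A basis of that weight contains all rungs and either diag 0 or spine d;
-- as the triangles {spine i, rung i, diag i} forbid spine i beside diag i, it then contains all
-- diagonals or all spines, i.e. it is v or u.  So the weights cut out [1_u, 1_v] as an edge.

open import Defs
open import Data.Bool using (Bool; true; false; if_then_else_; T)
open import Data.Bool.Properties using (T-≡; if-eta)
open import Data.Empty using (⊥; ⊥-elim)
open import Data.Fin using (Fin; zero; suc; toℕ; inject₁; fromℕ)
open import Data.Fin.Properties using (any?; _≟_; toℕ-injective; toℕ-fromℕ<; toℕ<n)
open import Data.Fin.Subset using (Subset; _∈_; _∉_; _⊆_; _-_; _─_; ⁅_⁆)
open import Data.Fin.Subset.Properties using (⊆-antisym; _∈?_; p─q⊆p; x∈p∧x≢y⇒x∈p-y; x∈⁅x⁆)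
import Data.Integer as ℤ
import Data.Integer.Properties as ℤP
open import Data.Nat using (NonZero; ℕ; zero; suc; _+_; _*_; _∸_; _≤_; _<_; _<ᵇ_; z≤n; s≤s; _≤?_)
open import Data.Nat.DivMod using (_mod_; _%_; _/_; m<n⇒m%n≡m; [m+kn]%n≡m%n; m≡m%n+[m/n]*n; m%n<n)
open import Data.Nat.Properties using (module ≤-Reasoning; ≤-refl; ≤-trans; ≤-total; ≤-pred; ≤-reflexive; <⇒≱; <-irrefl; <-asym; <⇒≤; ≮⇒≥; ≰⇒>; <ᵇ⇒<; 1+n≰n; 1+n≢0; m≤n⇒m<n∨m≡n; +-assoc; +-comm; +-suc; +-identityʳ; +-mono-≤; +-monoˡ-≤; +-monoʳ-≤; +-monoˡ-<; +-cancelˡ-≤; *-monoˡ-≤; *-distribˡ-+; m≤m+n; m≤n+m; m<m+n; n≤1+n; m+[n∸m]≡n)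
open import Data.Product using (Σ; ∃; ∃₂; _×_; _,_; proj₁; proj₂; map)
open import Data.Product.Properties using (,-injectiveˡ; ,-injectiveʳ)
open import Data.Rational as ℚ using (ℚ; *<*)
open import Data.Rational.Literals using (fromℤ)
open import Data.Rational.Properties using (toℚᵘ-injective; toℚᵘ-homo-+; +-identityˡ)
open import Data.Rational.Unnormalised using (*≡*)
open import Data.Rational.Unnormalised.Properties using (≃-sym; ≃-trans)
open import Data.Sum as Sum using (_⊎_; inj₁; inj₂; swap)
open import Data.Unit using (⊤; tt)
open import Data.Vec using (Vec; _∷_; []; lookup; tabulate; replicate; here; there)
open import Data.Vec.Properties using (lookup∘tabulate; []=⇒lookup; lookup⇒[]=)
open import Data.Vec.Relation.Unary.All using (All; _∷_; [])
open import Data.Vec.Relation.Unary.All.Properties using (lookup⁺)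
open import Data.Vec.Relation.Unary.AllPairs using (_∷_; [])
open import Data.Vec.Relation.Unary.Unique.Propositional using (Unique)
open import Data.Vec.Relation.Unary.Unique.Propositional.Properties using (lookup-injective)
open import Function using (_∘_; _⇔_; mk⇔; Equivalence)
open import Relation.Binary.PropositionalEquality using (_≡_; _≢_; refl; sym; trans; cong; cong₂; subst; subst₂; module ≡-Reasoning)
open import Relation.Nullary using (¬_; yes; no; contradiction)
open import Relation.Nullary.Decidable using (isYes; toWitness; fromWitness)

-- Cycles, circuits and forests

argmax : ∀ {k} (f : Fin (suc k) → ℕ) → ∃ λ j → ∀ i → f i ≤ f j
argmax {zero} f = zero , λ { zero → ≤-refl }
argmax {suc k} f with argmax (λ i → f (suc i))
... | j , f≤ with ≤-total (f zero) (f (suc j))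
...   | inj₁ f0≤ = suc j , λ { zero → f0≤ ; (suc i) → f≤ i }
...   | inj₂ f0≥ = zero , λ { zero → ≤-refl ; (suc i) → ≤-trans (f≤ i) f0≥ }

last-or-inject₁ : ∀ {k} (j : Fin (suc k)) → j ≡ fromℕ k ⊎ ∃ λ i → j ≡ inject₁ i
last-or-inject₁ {zero} zero = inj₁ refl
last-or-inject₁ {suc k} zero = inj₂ (zero , refl)
last-or-inject₁ {suc k} (suc j) with last-or-inject₁ j
... | inj₁ j≡last = inj₁ (cong suc j≡last)
... | inj₂ (i , j≡i) = inj₂ (suc i , cong suc j≡i)

x∈p─q⇒x∉q : ∀ {n} (p q : Subset n) {x} → x ∈ p ─ q → x ∉ q
x∈p─q⇒x∉q (_ ∷ p) (_ ∷ q) () here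
x∈p─q⇒x∉q (_ ∷ p) (_ ∷ q) (there x∈p─q) (there x∈q) = x∈p─q⇒x∉q p q x∈p─q x∈q

toℕ-mod : ∀ {c k} .{{_ : NonZero k}} → c < k → toℕ (c mod k) ≡ c
toℕ-mod c<k = trans (toℕ-fromℕ< _) (m<n⇒m%n≡m c<k)

module _ {m n : ℕ} (G : Graph m n) where

  Joins-unique : ∀ {e a b x y} → Joins G e a b → Joins G e x y → (a ≡ x × b ≡ y) ⊎ (a ≡ y × b ≡ x)
  Joins-unique (inj₁ p) (inj₁ q) = inj₁ (,-injectiveˡ (trans (sym p) q) , ,-injectiveʳ (trans (sym p) q))
  Joins-unique (inj₁ p) (inj₂ q) = inj₂ (,-injectiveˡ (trans (sym p) q) , ,-injectiveʳ (trans (sym p) q))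
  Joins-unique (inj₂ p) (inj₁ q) = inj₂ (,-injectiveʳ (trans (sym p) q) , ,-injectiveˡ (trans (sym p) q))
  Joins-unique (inj₂ p) (inj₂ q) = inj₁ (,-injectiveʳ (trans (sym p) q) , ,-injectiveˡ (trans (sym p) q))

  module _ {k} (c : Cycle G k) where
    open Cycle c

    prev : Fin (suc k) → Fin (suc k)
    prev zero = fromℕ k
    prev (suc i) = inject₁ i

    enters : ∀ j → Joins G (es (prev j)) (vs j) (vs (prev j))
    enters zero = swap close
    enters (suc i) = swap (step i)

    leaves : ∀ j → ∃ λ j′ → Joins G (es j) (vs j) (vs j′)
    leaves j with last-or-inject₁ j
    ... | inj₁ refl = zero , close
    ... | inj₂ (i , refl) = suc i , step i

  -- The highest vertex of a cycle is the upper endpoint of both cycle edges at it.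
  module Oriented (height : Fin m → ℕ) (head tail : Fin n → Fin m)
                  (joins : ∀ e → Joins G e (head e) (tail e))
                  (ascends : ∀ e → height (tail e) < height (head e)) where

    oriented : ∀ {e x y} → Joins G e x y → height y ≤ height x → head e ≡ x × tail e ≡ y
    oriented {e} j y≤x with Joins-unique (joins e) j
    ... | inj₁ h,t = h,t
    ... | inj₂ (refl , refl) = ⊥-elim (<⇒≱ (ascends e) y≤x)

    head-injective⇒no-cycle : (Π : Fin n → Set) → (∀ {e f} → Π e → Π f → head e ≡ head f → e ≡ f) →
                              ∀ {k} (c : Cycle G k) → ¬ (∀ i → Π (Cycle.es c i))
    head-injective⇒no-cycle Π injective c inΠ = <-irrefl refl tail<tail
      where
      open Cycle c
      top = proj₁ (argmax (λ i → height (vs i)))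
      highest = proj₂ (argmax (λ i → height (vs i)))
      e₁ = es (prev c top)
      in-oriented : head e₁ ≡ vs top × tail e₁ ≡ vs (prev c top)
      in-oriented = oriented (enters c top) (highest (prev c top))
      out-head : head (es top) ≡ vs top
      out-head = proj₁ (oriented (proj₂ (leaves c top)) (highest (proj₁ (leaves c top))))
      prev≡top : prev c top ≡ top
      prev≡top = es-inj (injective (inΠ (prev c top)) (inΠ top) (trans (proj₁ in-oriented) (sym out-head)))
      tail<tail : height (tail e₁) < height (tail e₁)
      tail<tail = subst (λ v → height (tail e₁) < height v)
                (trans (proj₁ in-oriented) (trans (cong vs (sym prev≡top)) (sym (proj₂ in-oriented))))
                (ascends e₁)

  edgeSet : ∀ {k} → Cycle G k → Subset n
  edgeSet c = tabulate λ e → isYes (any? λ i → Cycle.es c i ≟ e)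

  ∈-edgeSet : ∀ {k} (c : Cycle G k) {e} → e ∈ edgeSet c ⇔ ∃ λ i → Cycle.es c i ≡ e
  ∈-edgeSet c {e} = mk⇔
    (λ e∈ → toWitness {a? = hit?} (Equivalence.from T-≡ (trans (sym (lookup∘tabulate _ e)) ([]=⇒lookup e∈))))
    (λ hit → lookup⇒[]= e _ (trans (lookup∘tabulate _ e) (Equivalence.to T-≡ (fromWitness {a? = hit?} hit))))
    where hit? = any? λ i → Cycle.es c i ≟ e

  edgeSet-isCircuit : ∀ {k} (c : Cycle G k) → IsCircuit G (edgeSet c)
  edgeSet-isCircuit {k} c = k , c , λ e → ∈-edgeSet c

  independent⇒no-cycle : ∀ {W} → Independent G W → ∀ {k} (c : Cycle G k) → ¬ (∀ i → Cycle.es c i ∈ W)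
  independent⇒no-cycle {W} ind c es∈W = ind (edgeSet c) (edgeSet-isCircuit c) λ e∈ →
    let (i , esi≡e) = Equivalence.to (∈-edgeSet c) e∈ in subst (_∈ W) esi≡e (es∈W i)

  circuit⇒cycle : ∀ {C} → IsCircuit G C → ∃₂ λ k (c : Cycle G k) → ∀ i → Cycle.es c i ∈ C
  circuit⇒cycle (k , c , ∈C⇔) = k , c , λ i → Equivalence.from (∈C⇔ (Cycle.es c i)) (i , refl)

  closing-cycles⇒basis : ∀ {W} → Independent G W →
    (∀ e → e ∉ W → ∃₂ λ k (c : Cycle G k) → ∀ i → Cycle.es c i ≡ e ⊎ Cycle.es c i ∈ W) →
    IsBasis G W
  closing-cycles⇒basis {W} ind closes = ind , maximal
    where
    maximal : ∀ F → W ⊆ F → Independent G F → F ≡ W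
    maximal F W⊆F indF = ⊆-antisym F⊆W W⊆F
      where
      F⊆W : F ⊆ W
      F⊆W {e} e∈F with e ∈? W
      ... | yes e∈W = e∈W
      ... | no e∉W with closes e e∉W
      ...   | _ , c , inW∪e = ⊥-elim (independent⇒no-cycle indF c λ i → case (inW∪e i))
        where
        case : ∀ {f} → f ≡ e ⊎ f ∈ W → f ∈ F
        case (inj₁ refl) = e∈F
        case (inj₂ f∈W) = W⊆F f∈W

  module _ (O : Ordering n) where

    AboveIn : Subset n → Fin n → Fin n → Set
    AboveIn W e f = f ≡ e ⊎ (f ∈ W × rank O e < rank O f)

    no-cycle-above⇒no-broken-circuit : ∀ {W} → Independent G W →
      (∀ e → e ∉ W → ∀ {k} (c : Cycle G k) → ¬ (∀ i → AboveIn W e (Cycle.es c i))) →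
      ∀ D → IsBrokenCircuit G O D → ¬ (D ⊆ W)
    no-cycle-above⇒no-broken-circuit {W} ind noCycle _ (C , e , circ , e∈C , least , refl) C-e⊆W
      with circuit⇒cycle circ | e ∈? W
    ... | _ , c , es∈C | yes e∈W = independent⇒no-cycle ind c λ i → inW (es∈C i)
      where
      inW : ∀ {f} → f ∈ C → f ∈ W
      inW {f} f∈C with f ≟ e
      ... | yes refl = e∈W
      ... | no f≢e = C-e⊆W (x∈p∧x≢y⇒x∈p-y f∈C f≢e)
    ... | _ , c , es∈C | no e∉W = noCycle e e∉W c λ i → above (es∈C i)
      where
      above : ∀ {f} → f ∈ C → AboveIn W e f
      above {f} f∈C with f ≟ e
      ... | yes f≡e = inj₁ f≡e
      ... | no f≢e = inj₂ (C-e⊆W (x∈p∧x≢y⇒x∈p-y f∈C f≢e) , least f f∈C f≢e)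

    nbc-avoids-broken-cycle : ∀ {W} → (∀ D → IsBrokenCircuit G O D → ¬ (D ⊆ W)) →
      ∀ {k} (c : Cycle G k) j → (∀ i → i ≢ j → rank O (Cycle.es c j) < rank O (Cycle.es c i)) →
      ¬ (∀ i → i ≢ j → Cycle.es c i ∈ W)
    nbc-avoids-broken-cycle {W} nbc c j least others∈W =
      nbc (edgeSet c - es j) (edgeSet c , es j , edgeSet-isCircuit c , es∈ j , least′ , refl) sub
      where
      open Cycle c
      es∈ : ∀ i → es i ∈ edgeSet c
      es∈ i = Equivalence.from (∈-edgeSet c) (i , refl)
      least′ : ∀ f → f ∈ edgeSet c → f ≢ es j → rank O (es j) < rank O f
      least′ f f∈ f≢ej with Equivalence.to (∈-edgeSet c) f∈
      ... | i , refl = least i (λ i≡j → f≢ej (cong es i≡j))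
      sub : edgeSet c - es j ⊆ W
      sub {f} f∈ with Equivalence.to (∈-edgeSet c) (p─q⊆p _ _ f∈)
      ... | i , refl = others∈W i λ i≡j →
        x∈p─q⇒x∉q _ _ f∈ (subst (λ x → es i ∈ ⁅ x ⁆) (cong es i≡j) (x∈⁅x⁆ (es i)))

-- Hull edges cut out by natural-number weights

ι : ℕ → ℚ
ι k = fromℤ (ℤ.+ k)

ι-+ : ∀ a b → ι (a + b) ≡ ι a ℚ.+ ι b
ι-+ a b = toℚᵘ-injective (≃-sym (≃-trans (toℚᵘ-homo-+ (ι a) (ι b)) (*≡* cross)))
  where
  cross = trans (ℤP.*-identityʳ _)
            (trans (cong₂ ℤ._+_ (ℤP.*-identityʳ (ℤ.+ a)) (ℤP.*-identityʳ (ℤ.+ b)))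
                   (sym (trans (ℤP.*-identityʳ _) (ℤP.pos-+ a b))))

ι-< : ∀ {a b} → a < b → ι a ℚ.< ι b
ι-< a<b = *<* (subst₂ ℤ._<_ (sym (ℤP.*-identityʳ _)) (sym (ℤP.*-identityʳ _)) (ℤ.+<+ a<b))

dotℕ : ∀ {n} → (Fin n → ℕ) → Subset n → ℕ
dotℕ c [] = 0
dotℕ c (b ∷ u) = (if b then c zero else 0) + dotℕ (c ∘ suc) u

dotℕ-zero : ∀ {k} (w : Subset k) → dotℕ (λ _ → 0) w ≡ 0
dotℕ-zero [] = refl
dotℕ-zero (b ∷ w) = cong₂ _+_ (if-eta b) (dotℕ-zero w)

dot-ι : ∀ {n} (c : Fin n → ℕ) u → dot (ι ∘ c) u ≡ ι (dotℕ c u)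
dot-ι c [] = refl
dot-ι c (true ∷ u) = trans (cong (ι (c zero) ℚ.+_) (dot-ι (c ∘ suc) u)) (sym (ι-+ (c zero) (dotℕ (c ∘ suc) u)))
dot-ι c (false ∷ u) = trans (+-identityˡ _) (dot-ι (c ∘ suc) u)

edgeOfHull-by-weights : ∀ {n} {P : Subset n → Set} {u v} (c : Fin n → ℕ) → P u → P v → u ≢ v →
  dotℕ c u ≡ dotℕ c v → (∀ w → P w → w ≢ u → w ≢ v → dotℕ c w < dotℕ c u) → IsEdgeOfHull P u v
edgeOfHull-by-weights {u = u} {v} c Pu Pv u≢v cu≡cv below =
  Pu , Pv , u≢v , ι ∘ c ,
  trans (dot-ι c u) (trans (cong ι cu≡cv) (sym (dot-ι c v))) ,
  λ w Pw w≢u w≢v → subst₂ ℚ._<_ (sym (dot-ι c w)) (sym (dot-ι c u)) (ι-< (below w Pw w≢u w≢v))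

hamming-self : ∀ {n} (w : Subset n) → hamming w w ≡ 0
hamming-self [] = refl
hamming-self (true ∷ w) = hamming-self w
hamming-self (false ∷ w) = hamming-self w

-- Weights of block vectors

-- Positions past the end read as false.
bit : ∀ {k} → Subset k → ℕ → Bool
bit [] _ = false
bit (b ∷ w) zero = b
bit (b ∷ w) (suc t) = bit w t

bit-lookup : ∀ {k} (w : Subset k) e → bit w (toℕ e) ≡ lookup w e
bit-lookup (b ∷ w) zero = refl
bit-lookup (b ∷ w) (suc e) = bit-lookup w e

∈⇔bit : ∀ {k} {w : Subset k} {e} → e ∈ w ⇔ bit w (toℕ e) ≡ true
∈⇔bit {w = w} {e} = mk⇔ (λ e∈w → trans (bit-lookup w e) ([]=⇒lookup e∈w))
                         (λ set → lookup⇒[]= e w (trans (sym (bit-lookup w e)) set))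

bit-replicate : ∀ k t → bit (replicate k false) t ≡ false
bit-replicate zero t = refl
bit-replicate (suc k) zero = refl
bit-replicate (suc k) (suc t) = bit-replicate k t

-- Bits k is an edge vector without edge 0 (= diag 0): k blocks rung i, spine i, diag (i+1), chord i,
-- then rung k, spine k and r pads, weighted 4, 2, 2, 0 per block and 4, 1, 0 at the end.
module BlockWeights (r : ℕ) where

  Bits : ℕ → Set
  Bits k = Subset (2 + (k * 4 + r))

  blockWeight : ∀ k → Fin (2 + (k * 4 + r)) → ℕ
  blockWeight zero zero = 4
  blockWeight zero (suc zero) = 1
  blockWeight zero (suc (suc _)) = 0
  blockWeight (suc k) zero = 4
  blockWeight (suc k) (suc zero) = 2
  blockWeight (suc k) (suc (suc zero)) = 2
  blockWeight (suc k) (suc (suc (suc zero))) = 0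
  blockWeight (suc k) (suc (suc (suc (suc t)))) = blockWeight k t

  NoConflict : ∀ k → Bits k → Set
  NoConflict k w = ∀ i → i < k → bit w (1 + i * 4) ≡ true → bit w (2 + i * 4) ≡ true → ⊥

  Saturated : ∀ k → Bits k → Set
  Saturated k w =
    (∀ i → i < k → bit w (i * 4) ≡ true × (bit w (1 + i * 4) ≡ true ⊎ bit w (2 + i * 4) ≡ true)) ×
    bit w (k * 4) ≡ true

  blockValue : Bool → Bool → Bool → ℕ
  blockValue b₀ b₁ b₂ = (if b₀ then 4 else 0) + ((if b₁ then 2 else 0) + (if b₂ then 2 else 0))

  blockValue-≤ : ∀ b₀ b₁ b₂ → (b₁ ≡ true → b₂ ≡ true → ⊥) → blockValue b₀ b₁ b₂ ≤ 6
  blockValue-≤ _     true  true  conflict = ⊥-elim (conflict refl refl)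
  blockValue-≤ true  true  false _ = ≤-refl
  blockValue-≤ true  false true  _ = ≤-refl
  blockValue-≤ true  false false _ = s≤s (s≤s (s≤s (s≤s z≤n)))
  blockValue-≤ false true  false _ = s≤s (s≤s z≤n)
  blockValue-≤ false false true  _ = s≤s (s≤s z≤n)
  blockValue-≤ false false false _ = z≤n

  blockValue-≥ : ∀ b₀ b₁ b₂ → 5 ≤ blockValue b₀ b₁ b₂ → b₀ ≡ true × (b₁ ≡ true ⊎ b₂ ≡ true)
  blockValue-≥ true  true  _     _ = refl , inj₁ refl
  blockValue-≥ true  false true  _ = refl , inj₂ refl
  blockValue-≥ true  false false (s≤s (s≤s (s≤s (s≤s ()))))
  blockValue-≥ false true  true  (s≤s (s≤s (s≤s (s≤s ()))))
  blockValue-≥ false true  false (s≤s (s≤s ()))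
  blockValue-≥ false false true  (s≤s (s≤s ()))
  blockValue-≥ false false false ()

  block-split : ∀ {k} b₀ b₁ b₂ b₃ (w : Bits k) →
    dotℕ (blockWeight (suc k)) (b₀ ∷ b₁ ∷ b₂ ∷ b₃ ∷ w) ≡ blockValue b₀ b₁ b₂ + dotℕ (blockWeight k) w
  block-split {k} b₀ b₁ b₂ b₃ w = begin
    v₀ + (v₁ + (v₂ + ((if b₃ then 0 else 0) + S))) ≡⟨ cong (λ z → v₀ + (v₁ + (v₂ + (z + S)))) (if-eta b₃) ⟩
    v₀ + (v₁ + (v₂ + S))                           ≡⟨ cong (v₀ +_) (+-assoc v₁ v₂ S) ⟨
    v₀ + ((v₁ + v₂) + S)                           ≡⟨ +-assoc v₀ (v₁ + v₂) S ⟨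
    blockValue b₀ b₁ b₂ + S                        ∎
    where
    open ≡-Reasoning
    v₀ = if b₀ then 4 else 0
    v₁ = if b₁ then 2 else 0
    v₂ = if b₂ then 2 else 0
    S = dotℕ (blockWeight k) w

  lastValue : Bool → Bool → ℕ
  lastValue c₀ c₁ = (if c₀ then 4 else 0) + (if c₁ then 1 else 0)

  lastValue-≤ : ∀ c₀ c₁ → lastValue c₀ c₁ ≤ 5
  lastValue-≤ true  true  = ≤-refl
  lastValue-≤ true  false = s≤s (s≤s (s≤s (s≤s z≤n)))
  lastValue-≤ false true  = s≤s z≤n
  lastValue-≤ false false = z≤n

  lastValue-≥4 : ∀ c₀ c₁ → 4 ≤ lastValue c₀ c₁ → c₀ ≡ true
  lastValue-≥4 true  _     _ = refl
  lastValue-≥4 false true  (s≤s ())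
  lastValue-≥4 false false ()

  lastValue-≥5 : ∀ c₀ c₁ → 5 ≤ lastValue c₀ c₁ → c₁ ≡ true
  lastValue-≥5 _     true  _ = refl
  lastValue-≥5 true  false (s≤s (s≤s (s≤s (s≤s ()))))
  lastValue-≥5 false false ()

  last-split : ∀ c₀ c₁ (w : Subset r) → dotℕ (blockWeight 0) (c₀ ∷ c₁ ∷ w) ≡ lastValue c₀ c₁
  last-split c₀ c₁ w =
    cong ((if c₀ then 4 else 0) +_) (trans (cong ((if c₁ then 1 else 0) +_) (dotℕ-zero w)) (+-identityʳ _))

  weight-≤ : ∀ k (w : Bits k) → NoConflict k w → dotℕ (blockWeight k) w ≤ k * 6 + 5
  weight-≤ zero (c₀ ∷ c₁ ∷ w) _ = subst (_≤ 5) (sym (last-split c₀ c₁ w)) (lastValue-≤ c₀ c₁)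
  weight-≤ (suc k) (b₀ ∷ b₁ ∷ b₂ ∷ b₃ ∷ w) noConflict = begin
    dotℕ (blockWeight (suc k)) (b₀ ∷ b₁ ∷ b₂ ∷ b₃ ∷ w) ≡⟨ block-split {k} b₀ b₁ b₂ b₃ w ⟩
    blockValue b₀ b₁ b₂ + dotℕ (blockWeight k) w        ≤⟨ +-mono-≤ (blockValue-≤ b₀ b₁ b₂ (noConflict 0 (s≤s z≤n)))
                                                              (weight-≤ k w λ i i<k → noConflict (suc i) (s≤s i<k)) ⟩
    6 + (k * 6 + 5)                                     ∎
    where open ≤-Reasoning

  weight-≥⇒saturated : ∀ k (w : Bits k) → NoConflict k w →
    k * 6 + 4 ≤ dotℕ (blockWeight k) w → Saturated k w
  weight-≥⇒saturated zero (c₀ ∷ c₁ ∷ w) _ heavy =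
    (λ _ ()) , lastValue-≥4 c₀ c₁ (subst (4 ≤_) (last-split c₀ c₁ w) heavy)
  weight-≥⇒saturated (suc k) (b₀ ∷ b₁ ∷ b₂ ∷ b₃ ∷ w) noConflict heavy′ = saturated , proj₂ rest
    where
    heavy = subst (suc k * 6 + 4 ≤_) (block-split {k} b₀ b₁ b₂ b₃ w) heavy′
    S = dotℕ (blockWeight k) w
    noConflict′ : NoConflict k w
    noConflict′ i i<k = noConflict (suc i) (s≤s i<k)
    value≤6 = blockValue-≤ b₀ b₁ b₂ (noConflict 0 (s≤s z≤n))
    value≥5 : 5 ≤ blockValue b₀ b₁ b₂
    value≥5 with 5 ≤? blockValue b₀ b₁ b₂
    ... | yes ≥5 = ≥5
    ... | no ≱5 = ⊥-elim (1+n≰n (subst (suc k * 6 + 4 ≤_) (cong (4 +_) (+-suc (k * 6) 4))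
                       (≤-trans heavy (+-mono-≤ (≤-pred (≰⇒> ≱5)) (weight-≤ k w noConflict′)))))
    rest = weight-≥⇒saturated k w noConflict′
             (+-cancelˡ-≤ 6 _ _ (≤-trans heavy (+-monoˡ-≤ S value≤6)))
    saturated : ∀ i → i < suc k → _
    saturated zero _ = blockValue-≥ b₀ b₁ b₂ value≥5
    saturated (suc i) (s≤s i<k) = proj₁ rest i i<k

  weight-max⇒last : ∀ k (w : Bits k) → NoConflict k w →
    k * 6 + 5 ≤ dotℕ (blockWeight k) w → bit w (1 + k * 4) ≡ true
  weight-max⇒last zero (c₀ ∷ c₁ ∷ w) _ heaviest = lastValue-≥5 c₀ c₁ (subst (5 ≤_) (last-split c₀ c₁ w) heaviest)
  weight-max⇒last (suc k) (b₀ ∷ b₁ ∷ b₂ ∷ b₃ ∷ w) noConflict heaviest =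
    weight-max⇒last k w (λ i i<k → noConflict (suc i) (s≤s i<k))
      (+-cancelˡ-≤ 6 _ _ (≤-trans (subst (suc k * 6 + 5 ≤_) (block-split {k} b₀ b₁ b₂ b₃ w) heaviest)
                                  (+-monoˡ-≤ _ (blockValue-≤ b₀ b₁ b₂ (noConflict 0 (s≤s z≤n))))))

-- Vertex and edge names

data Vertex : Set where
  a b : ℕ → Vertex

data EdgeName : Set where
  rung spine diag chord : ℕ → EdgeName
  pad : EdgeName

endpoints : EdgeName → Vertex × Vertex
endpoints (rung i)  = a (suc i) , b (suc i)
endpoints (spine i) = a i , a (suc i)
endpoints (diag i)  = a i , b (suc i)
endpoints (chord i) = a i , b (2 + i)
endpoints pad       = a 0 , b 2

priority : EdgeName → ℕ
priority (rung _)  = 0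
priority (chord _) = 1
priority pad       = 1
priority (spine _) = 2
priority (diag _)  = 3

ValidIn : ℕ → EdgeName → Set
ValidIn k (rung i)  = i ≤ k
ValidIn k (spine i) = i ≤ k
ValidIn k (diag i)  = i ≤ k
ValidIn k (chord i) = i < k
ValidIn k pad       = ⊤

pos : EdgeName → ℕ
pos (diag zero)    = 0
pos (rung i)       = 1 + i * 4
pos (spine i)      = 2 + i * 4
pos (diag (suc i)) = 3 + i * 4
pos (chord i)      = 4 + i * 4
pos pad            = 0    -- junk: pads have no single position

shift : EdgeName → EdgeName
shift (rung i)  = rung (suc i)
shift (spine i) = spine (suc i)
shift (diag i)  = diag (suc i)
shift (chord i) = chord (suc i)
shift pad       = pad

-- Edge 0 is diag 0 and edge 1 + t is blockName d t.
blockName : ℕ → ℕ → EdgeName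
blockName zero    0 = rung 0
blockName zero    1 = spine 0
blockName zero    (suc (suc _)) = pad
blockName (suc k) 0 = rung 0
blockName (suc k) 1 = spine 0
blockName (suc k) 2 = diag 1
blockName (suc k) 3 = chord 0
blockName (suc k) (suc (suc (suc (suc t)))) = shift (blockName k t)

Placed : ℕ → ℕ → EdgeName → Set
Placed k t x = ValidIn k x × (x ≢ pad → t ≡ pos x)

shift-placed : ∀ {k t} x → Placed k (suc t) x → Placed (suc k) (5 + t) (shift x)
shift-placed (rung i)       (i≤k , at) = s≤s i≤k , λ _ → cong (4 +_) (at λ ())
shift-placed (spine i)      (i≤k , at) = s≤s i≤k , λ _ → cong (4 +_) (at λ ())
shift-placed (diag zero)    (_ , at) = ⊥-elim (1+n≢0 (at λ ()))
shift-placed (diag (suc i)) (i<k , at) = s≤s i<k , λ _ → cong (4 +_) (at λ ())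
shift-placed (chord i)      (i<k , at) = s≤s i<k , λ _ → cong (4 +_) (at λ ())
shift-placed pad            _ = tt , λ pad≢pad → ⊥-elim (pad≢pad refl)

blockName-placed : ∀ k t → Placed k (suc t) (blockName k t)
blockName-placed zero    0 = z≤n , λ _ → refl
blockName-placed zero    1 = z≤n , λ _ → refl
blockName-placed zero    (suc (suc _)) = tt , λ pad≢pad → ⊥-elim (pad≢pad refl)
blockName-placed (suc k) 0 = z≤n , λ _ → refl
blockName-placed (suc k) 1 = z≤n , λ _ → refl
blockName-placed (suc k) 2 = s≤s z≤n , λ _ → refl
blockName-placed (suc k) 3 = s≤s z≤n , λ _ → refl
blockName-placed (suc k) (suc (suc (suc (suc t)))) = shift-placed (blockName k t) (blockName-placed k t)

blockName-rung : ∀ k i → i ≤ k → blockName k (i * 4) ≡ rung i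
blockName-rung zero    zero    _ = refl
blockName-rung (suc k) zero    _ = refl
blockName-rung (suc k) (suc i) (s≤s i≤k) = cong shift (blockName-rung k i i≤k)

blockName-spine : ∀ k i → i ≤ k → blockName k (1 + i * 4) ≡ spine i
blockName-spine zero    zero    _ = refl
blockName-spine (suc k) zero    _ = refl
blockName-spine (suc k) (suc i) (s≤s i≤k) = cong shift (blockName-spine k i i≤k)

blockName-diag : ∀ k i → i < k → blockName k (2 + i * 4) ≡ diag (suc i)
blockName-diag (suc k) zero    _ = refl
blockName-diag (suc k) (suc i) (s≤s i<k) = cong shift (blockName-diag k i i<k)

blockName-chord : ∀ k i → i < k → blockName k (3 + i * 4) ≡ chord i
blockName-chord (suc k) zero    _ = refl
blockName-chord (suc k) (suc i) (s≤s i<k) = cong shift (blockName-chord k i i<k)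

code : Vertex → ℕ
code (a i) = i * 2
code (b j) = 1 + j * 2

next : Vertex → Vertex
next (a i) = a (suc i)
next (b j) = b (suc j)

decode : ℕ → Vertex
decode zero = a 0
decode (suc zero) = b 0
decode (suc (suc c)) = next (decode c)

decode-code : ∀ v → decode (code v) ≡ v
decode-code (a zero) = refl
decode-code (a (suc i)) = cong next (decode-code (a i))
decode-code (b zero) = refl
decode-code (b (suc j)) = cong next (decode-code (b j))

upper lower : (EdgeName → Bool) → EdgeName → Vertex
upper flipped x = if flipped x then proj₁ (endpoints x) else proj₂ (endpoints x)
lower flipped x = if flipped x then proj₂ (endpoints x) else proj₁ (endpoints x)

Spans : EdgeName → Vertex → Vertex → Set
Spans x p q = endpoints x ≡ (p , q) ⊎ endpoints x ≡ (q , p)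

spans-upper : ∀ f x → Spans x (upper f x) (lower f x)
spans-upper f x with f x
... | true  = inj₁ refl
... | false = inj₂ refl

record Orientation : Set where
  field
    level   : Vertex → ℕ
    flipped : EdgeName → Bool
    ascends : ∀ x → level (lower flipped x) < level (upper flipped x)

-- levels k puts a i between b (i + k - 1) and b (i + k).  With k = 0 the upper endpoints of
-- rungs ∪ spines, and of spines and one chord, are distinct; with k = 1 those of rungs ∪ diagonals
-- and of diagonals and one spine; with k = 2 those of diagonals and one chord.
levels : ℕ → Vertex → ℕ
levels k (a i) = suc ((k + i) * 2)
levels k (b j) = suc j * 2

gap : ∀ x c₁ c₂ → T (c₁ <ᵇ c₂) → c₁ + x < c₂ + x
gap x c₁ c₂ c₁<c₂ = +-monoˡ-< x (<ᵇ⇒< c₁ c₂ c₁<c₂)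

orientation₀ : Orientation
orientation₀ = record { level = levels 0 ; flipped = λ _ → false ; ascends = ascends }
  where
  ascends : ∀ x → levels 0 (proj₁ (endpoints x)) < levels 0 (proj₂ (endpoints x))
  ascends (rung i)  = gap (i * 2) 3 4 _
  ascends (spine i) = gap (i * 2) 1 3 _
  ascends (diag i)  = gap (i * 2) 1 4 _
  ascends (chord i) = gap (i * 2) 1 6 _
  ascends pad       = gap 0 1 6 _

orientation₁ : Orientation
orientation₁ = record { level = levels 1 ; flipped = flipped ; ascends = ascends }
  where
  flipped : EdgeName → Bool
  flipped (rung _) = true
  flipped _        = false
  ascends : ∀ x → levels 1 (lower flipped x) < levels 1 (upper flipped x)
  ascends (rung i)  = gap (i * 2) 4 5 _
  ascends (spine i) = gap (i * 2) 3 5 _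
  ascends (diag i)  = gap (i * 2) 3 4 _
  ascends (chord i) = gap (i * 2) 3 6 _
  ascends pad       = gap 0 3 6 _

orientation₂ : Orientation
orientation₂ = record { level = levels 2 ; flipped = flipped ; ascends = ascends }
  where
  flipped : EdgeName → Bool
  flipped (rung _) = true
  flipped (diag _) = true
  flipped _        = false
  ascends : ∀ x → levels 2 (lower flipped x) < levels 2 (upper flipped x)
  ascends (rung i)  = gap (i * 2) 4 7 _
  ascends (spine i) = gap (i * 2) 5 7 _
  ascends (diag i)  = gap (i * 2) 4 5 _
  ascends (chord i) = gap (i * 2) 5 6 _
  ascends pad       = gap 0 5 6 _

rungOrSpine rungOrDiag isSpine isDiag : EdgeName → Bool
rungOrSpine (rung _)  = true
rungOrSpine (spine _) = true
rungOrSpine _         = false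
rungOrDiag (rung _)  = true
rungOrDiag (diag _)  = true
rungOrDiag _         = false
isSpine (spine _) = true
isSpine _         = false
isDiag (diag _) = true
isDiag _        = false

class-not-pad : ∀ (K : EdgeName → Bool) {x} → K pad ≡ false → K x ≡ true → x ≢ pad
class-not-pad K noPad Kx refl = contradiction (trans (sym noPad) Kx) λ ()

HeadInjective : Orientation → (EdgeName → Bool) → Set
HeadInjective o K = ∀ x y → K x ≡ true → K y ≡ true → upper (flipped o) x ≡ upper (flipped o) y → x ≡ y
  where open Orientation

Separated : Orientation → EdgeName → (EdgeName → Bool) → Set
Separated o x K = ∀ y → K y ≡ true → upper (flipped o) x ≢ upper (flipped o) y
  where open Orientation

rungOrSpine-heads : HeadInjective orientation₀ rungOrSpine
rungOrSpine-heads (rung i)  (rung .i)  _ _ refl = refl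
rungOrSpine-heads (spine i) (spine .i) _ _ refl = refl

rungOrDiag-heads : HeadInjective orientation₁ rungOrDiag
rungOrDiag-heads (rung i) (rung .i) _ _ refl = refl
rungOrDiag-heads (diag i) (diag .i) _ _ refl = refl

spine-heads₀ : HeadInjective orientation₀ isSpine
spine-heads₀ (spine i) (spine .i) _ _ refl = refl

diag-heads₁ : HeadInjective orientation₁ isDiag
diag-heads₁ (diag i) (diag .i) _ _ refl = refl

diag-heads₂ : HeadInjective orientation₂ isDiag
diag-heads₂ (diag i) (diag .i) _ _ refl = refl

data ChordOf : ℕ → EdgeName → Set where
  chord : ∀ i → ChordOf i (chord i)
  pad   : ChordOf 0 pad

chord-endpoints : ∀ {i x} → ChordOf i x → endpoints x ≡ (a i , b (2 + i))
chord-endpoints (chord i) = refl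
chord-endpoints pad       = refl

chord-priority : ∀ {i x} → ChordOf i x → priority x ≡ 1
chord-priority (chord i) = refl
chord-priority pad       = refl

chord-spine-separated : ∀ {i x} → ChordOf i x → Separated orientation₀ x isSpine
chord-spine-separated (chord i) (spine j) _ ()
chord-spine-separated pad       (spine j) _ ()

chord-diag-separated : ∀ {i x} → ChordOf i x → Separated orientation₂ x isDiag
chord-diag-separated (chord i) (diag j) _ ()
chord-diag-separated pad       (diag j) _ ()

spine-diag-separated : ∀ i → Separated orientation₁ (spine i) isDiag
spine-diag-separated i (diag j) _ ()

chord-distinct : ∀ {i x} → ChordOf i x → ∀ {y} → priority y ≢ 1 → y ≢ x
chord-distinct c notChord refl = notChord (chord-priority c)

rungOrSpine-shift : ∀ x → rungOrSpine (shift x) ≡ rungOrSpine x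
rungOrSpine-shift (rung _)  = refl
rungOrSpine-shift (spine _) = refl
rungOrSpine-shift (diag _)  = refl
rungOrSpine-shift (chord _) = refl
rungOrSpine-shift pad       = refl

rungOrDiag-shift : ∀ x → rungOrDiag (shift x) ≡ rungOrDiag x
rungOrDiag-shift (rung _)  = refl
rungOrDiag-shift (spine _) = refl
rungOrDiag-shift (diag _)  = refl
rungOrDiag-shift (chord _) = refl
rungOrDiag-shift pad       = refl

rungOrSpine-≥1⇒spine : ∀ y → rungOrSpine y ≡ true → 1 ≤ priority y → isSpine y ≡ true
rungOrSpine-≥1⇒spine (spine _) _ _ = refl

rungOrSpine-≱3 : ∀ y → rungOrSpine y ≡ true → 3 ≤ priority y → ⊥
rungOrSpine-≱3 (spine _) _ (s≤s (s≤s ()))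

rungOrDiag-≥1⇒diag : ∀ y → rungOrDiag y ≡ true → 1 ≤ priority y → isDiag y ≡ true
rungOrDiag-≥1⇒diag (diag _) _ _ = refl

size-≤-distance : ∀ k r → r < 4 → 3 + (k * 4 + r) ≤ 3 * (2 + k * 2)
size-≤-distance zero    r r<4 = +-monoʳ-≤ 3 (≤-pred r<4)
size-≤-distance (suc k) r r<4 =
  ≤-trans (+-mono-≤ (<ᵇ⇒< 3 6 _) (size-≤-distance k r r<4)) (≤-reflexive (sym (*-distribˡ-+ 3 2 (2 + k * 2))))

-- The graph with d = suc d₀ and r pads

module Construction (d₀ r : ℕ) where

  d n m : ℕ
  d = suc d₀
  n = 3 + (d * 4 + r)
  m = 4 + d * 2

  Valid : EdgeName → Set
  Valid = ValidIn d

  nameAt : ℕ → EdgeName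
  nameAt zero = diag 0
  nameAt (suc t) = blockName d t

  nameAt-placed : ∀ t → Placed d t (nameAt t)
  nameAt-placed zero = z≤n , λ _ → refl
  nameAt-placed (suc t) = blockName-placed d t

  nameAt-pos : ∀ x → Valid x → x ≢ pad → nameAt (pos x) ≡ x
  nameAt-pos (rung i)       i≤d _ = blockName-rung d i i≤d
  nameAt-pos (spine i)      i≤d _ = blockName-spine d i i≤d
  nameAt-pos (diag zero)    _   _ = refl
  nameAt-pos (diag (suc i)) i<d _ = blockName-diag d i i<d
  nameAt-pos (chord i)      i<d _ = blockName-chord d i i<d
  nameAt-pos pad            _   pad≢pad = ⊥-elim (pad≢pad refl)

  name : Fin n → EdgeName
  name e = nameAt (toℕ e)

  name-valid : ∀ e → Valid (name e)
  name-valid e = proj₁ (nameAt-placed (toℕ e))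

  name-injective : ∀ {e f} → name e ≡ name f → name e ≢ pad → e ≡ f
  name-injective {e} {f} same notPad =
    toℕ-injective (trans (at e notPad) (trans (cong pos same) (sym (at f (notPad ∘ trans same)))))
    where
    at : ∀ e → name e ≢ pad → toℕ e ≡ pos (name e)
    at e = proj₂ (nameAt-placed (toℕ e))

  block-≤ : ∀ {i} → i < d → 4 + i * 4 ≤ d * 4 + r
  block-≤ i<d = ≤-trans (*-monoˡ-≤ 4 i<d) (m≤m+n (d * 4) r)

  pos<n : ∀ x → Valid x → pos x < n
  pos<n (rung i)       i≤d = s≤s (s≤s (≤-trans (*-monoˡ-≤ 4 i≤d) (≤-trans (m≤m+n (d * 4) r) (n≤1+n _))))
  pos<n (spine i)      i≤d = s≤s (s≤s (s≤s (≤-trans (*-monoˡ-≤ 4 i≤d) (m≤m+n (d * 4) r))))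
  pos<n (diag zero)    _   = s≤s z≤n
  pos<n (diag (suc i)) i<d = s≤s (s≤s (s≤s (≤-trans (m≤n+m (suc (i * 4)) 3) (block-≤ i<d))))
  pos<n (chord i)      i<d = s≤s (s≤s (s≤s (≤-trans (m≤n+m (2 + i * 4) 2) (block-≤ i<d))))
  pos<n pad            _   = s≤s z≤n

  edgeOf : EdgeName → Fin n
  edgeOf x = pos x mod n

  toℕ-edgeOf : ∀ x → Valid x → toℕ (edgeOf x) ≡ pos x
  toℕ-edgeOf x valid = toℕ-mod (pos<n x valid)

  name-edgeOf : ∀ x → Valid x → x ≢ pad → name (edgeOf x) ≡ x
  name-edgeOf x valid notPad = trans (cong nameAt (toℕ-edgeOf x valid)) (nameAt-pos x valid notPad)

  InRange : Vertex → Set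
  InRange v = code v < m

  vertex : Vertex → Fin m
  vertex v = code v mod m

  vertex-injective : ∀ {v w} → InRange v → InRange w → vertex v ≡ vertex w → v ≡ w
  vertex-injective {v} {w} v<m w<m same = begin
    v                         ≡⟨ decode-code v ⟨
    decode (code v)           ≡⟨ cong decode (toℕ-mod v<m) ⟨
    decode (toℕ (vertex v))   ≡⟨ cong (decode ∘ toℕ) same ⟩
    decode (toℕ (vertex w))   ≡⟨ cong decode (toℕ-mod w<m) ⟩
    decode (code w)           ≡⟨ decode-code w ⟩
    w                         ∎
    where open ≡-Reasoning

  a-in-range : ∀ {i} → i ≤ suc d → InRange (a i)
  a-in-range i≤ = s≤s (≤-trans (*-monoˡ-≤ 2 i≤) (n≤1+n _))

  b-in-range : ∀ {j} → j ≤ suc d → InRange (b j)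
  b-in-range j≤ = s≤s (s≤s (*-monoˡ-≤ 2 j≤))

  endpoints-in-range : ∀ x → Valid x → InRange (proj₁ (endpoints x)) × InRange (proj₂ (endpoints x))
  endpoints-in-range (rung i)  i≤d = a-in-range (s≤s i≤d) , b-in-range (s≤s i≤d)
  endpoints-in-range (spine i) i≤d = a-in-range (≤-trans i≤d (n≤1+n d)) , a-in-range (s≤s i≤d)
  endpoints-in-range (diag i)  i≤d = a-in-range (≤-trans i≤d (n≤1+n d)) , b-in-range (s≤s i≤d)
  endpoints-in-range (chord i) i<d = a-in-range (≤-trans (n≤1+n i) (≤-trans i<d (n≤1+n d))) , b-in-range (s≤s i<d)
  endpoints-in-range pad       _   = a-in-range z≤n , b-in-range (s≤s (s≤s z≤n))

  G : Graph m n
  G = record { ends = λ e → map vertex vertex (endpoints (name e)) }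

  joins-spans : ∀ e {x p q} → name e ≡ x → Spans x p q → Joins G e (vertex p) (vertex q)
  joins-spans _ refl (inj₁ eq) = inj₁ (cong (map vertex vertex) eq)
  joins-spans _ refl (inj₂ eq) = inj₂ (cong (map vertex vertex) eq)

  edgeRank : Fin n → ℕ
  edgeRank e = toℕ e + priority (name e) * n

  rank-injective : ∀ {e f} → edgeRank e ≡ edgeRank f → e ≡ f
  rank-injective {e} {f} same = toℕ-injective (trans (residue e) (trans (cong (_% n) same) (sym (residue f))))
    where
    residue : ∀ e → toℕ e ≡ edgeRank e % n
    residue e = sym (trans ([m+kn]%n≡m%n (toℕ e) (priority (name e)) n) (m<n⇒m%n≡m (toℕ<n e)))

  O : Ordering n
  O = record { rank = edgeRank ; rank-inj = rank-injective }

  rank-< : ∀ {e f} → priority (name e) < priority (name f) → edgeRank e < edgeRank f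
  rank-< {e} {f} p<q = begin-strict
    toℕ e + p * n  <⟨ +-monoˡ-< (p * n) (toℕ<n e) ⟩
    suc p * n      ≤⟨ *-monoˡ-≤ n p<q ⟩
    q * n          ≤⟨ m≤n+m (q * n) (toℕ f) ⟩
    toℕ f + q * n  ∎
    where
    open ≤-Reasoning
    p = priority (name e)
    q = priority (name f)

  rank-<⇒priority-≤ : ∀ {e f} → edgeRank e < edgeRank f → priority (name e) ≤ priority (name f)
  rank-<⇒priority-≤ {e} {f} e<f = ≮⇒≥ λ q<p → <-asym e<f (rank-< {f} {e} q<p)

  upper-in-range : ∀ f {x} → Valid x → InRange (upper f x)
  upper-in-range f {x} valid with f x
  ... | true  = proj₁ (endpoints-in-range x valid)
  ... | false = proj₂ (endpoints-in-range x valid)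

  lower-in-range : ∀ f {x} → Valid x → InRange (lower f x)
  lower-in-range f {x} valid with f x
  ... | true  = proj₂ (endpoints-in-range x valid)
  ... | false = proj₁ (endpoints-in-range x valid)

  module Forest (o : Orientation) where
    open Orientation o

    head tail : Fin n → Fin m
    head e = vertex (upper flipped (name e))
    tail e = vertex (lower flipped (name e))

    height : Fin m → ℕ
    height v = level (decode (toℕ v))

    height-vertex : ∀ {v} → InRange v → height (vertex v) ≡ level v
    height-vertex {v} v<m = cong level (trans (cong decode (toℕ-mod v<m)) (decode-code v))

    ascends′ : ∀ e → height (tail e) < height (head e)
    ascends′ e = subst₂ _<_ (sym (height-vertex (lower-in-range flipped (name-valid e))))
                            (sym (height-vertex (upper-in-range flipped (name-valid e))))
                            (ascends (name e))

    open Oriented G height head tail (λ e → joins-spans e refl (spans-upper flipped (name e))) ascends′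

    upper-injective : ∀ e f → head e ≡ head f → upper flipped (name e) ≡ upper flipped (name f)
    upper-injective e f = vertex-injective (upper-in-range flipped (name-valid e)) (upper-in-range flipped (name-valid f))

    heads-injective : ∀ {K} → K pad ≡ false → HeadInjective o K →
                      ∀ {e f} → K (name e) ≡ true → K (name f) ≡ true → head e ≡ head f → e ≡ f
    heads-injective {K} noPad injective {e} {f} Ke Kf same =
      name-injective (injective _ _ Ke Kf (upper-injective e f same)) (class-not-pad K noPad Ke)

    no-cycle-in-class : ∀ {K} → K pad ≡ false → HeadInjective o K →
                        ∀ {k} (c : Cycle G k) → ¬ (∀ i → K (name (Cycle.es c i)) ≡ true)
    no-cycle-in-class {K} noPad injective =
      head-injective⇒no-cycle (λ e → K (name e) ≡ true) (heads-injective noPad injective)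

    no-cycle-through : ∀ {K} → K pad ≡ false → HeadInjective o K → ∀ e₀ → Separated o (name e₀) K →
                       ∀ {k} (c : Cycle G k) → ¬ (∀ i → Cycle.es c i ≡ e₀ ⊎ K (name (Cycle.es c i)) ≡ true)
    no-cycle-through {K} noPad injective e₀ separated =
      head-injective⇒no-cycle (λ e → e ≡ e₀ ⊎ K (name e) ≡ true) injective′
      where
      injective′ : ∀ {e f} → e ≡ e₀ ⊎ K (name e) ≡ true → f ≡ e₀ ⊎ K (name f) ≡ true →
                   head e ≡ head f → e ≡ f
      injective′ (inj₁ refl) (inj₁ refl) _    = refl
      injective′ {f = f} (inj₁ refl) (inj₂ Kf) same = ⊥-elim (separated _ Kf (upper-injective e₀ f same))
      injective′ {e = e} (inj₂ Ke) (inj₁ refl) same = ⊥-elim (separated _ Ke (sym (upper-injective e e₀ same)))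
      injective′ (inj₂ Ke)   (inj₂ Kf)   same = heads-injective noPad injective Ke Kf same

  polygon : ∀ {k} (ps : Vec Vertex (suc k)) (xs : Vec EdgeName (suc k)) (es : Vec (Fin n) (suc k)) →
    (∀ i → name (lookup es i) ≡ lookup xs i) → All InRange ps → Unique ps → Unique xs →
    (∀ i → Spans (lookup xs (inject₁ i)) (lookup ps (inject₁ i)) (lookup ps (suc i))) →
    Spans (lookup xs (fromℕ k)) (lookup ps (fromℕ k)) (lookup ps zero) → Cycle G k
  polygon {k} ps xs es named inRange distinctPs distinctXs steps closing = record
    { vs     = λ i → vertex (lookup ps i)
    ; es     = lookup es
    ; vs-inj = λ {i} {j} same → lookup-injective distinctPs i j
                 (vertex-injective (lookup⁺ inRange i) (lookup⁺ inRange j) same)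
    ; es-inj = λ {i} {j} same → lookup-injective distinctXs i j (trans (sym (named i)) (trans (cong name same) (named j)))
    ; step   = λ i → joins-spans (lookup es (inject₁ i)) (named (inject₁ i)) (steps i)
    ; close  = joins-spans (lookup es (fromℕ k)) (named (fromℕ k)) closing
    }

  triangle : ∀ {i} → i ≤ d → (s q δ : Fin n) → name s ≡ spine i → name q ≡ rung i → name δ ≡ diag i → Cycle G 2
  triangle {i} i≤d s q δ ns nq nδ = polygon
    (a i ∷ a (suc i) ∷ b (suc i) ∷ []) (spine i ∷ rung i ∷ diag i ∷ []) (s ∷ q ∷ δ ∷ [])
    (λ { zero → ns ; (suc zero) → nq ; (suc (suc zero)) → nδ })
    (a-in-range (≤-trans i≤d (n≤1+n d)) ∷ a-in-range (s≤s i≤d) ∷ b-in-range (s≤s i≤d) ∷ [])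
    (((λ ()) ∷ (λ ()) ∷ []) ∷ ((λ ()) ∷ []) ∷ [] ∷ [])
    (((λ ()) ∷ (λ ()) ∷ []) ∷ ((λ ()) ∷ []) ∷ [] ∷ [])
    (λ { zero → inj₁ refl ; (suc zero) → inj₁ refl })
    (inj₂ refl)

  chordTriangle : ∀ {i} → i < d → (s δ x : Fin n) →
    name s ≡ spine i → name δ ≡ diag (suc i) → name x ≡ chord i → Cycle G 2
  chordTriangle {i} i<d s δ x ns nδ nx = polygon
    (a i ∷ a (suc i) ∷ b (2 + i) ∷ []) (spine i ∷ diag (suc i) ∷ chord i ∷ []) (s ∷ δ ∷ x ∷ [])
    (λ { zero → ns ; (suc zero) → nδ ; (suc (suc zero)) → nx })
    (a-in-range (≤-trans (n≤1+n i) (≤-trans i<d (n≤1+n d))) ∷ a-in-range (≤-trans i<d (n≤1+n d)) ∷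
     b-in-range (s≤s i<d) ∷ [])
    (((λ ()) ∷ (λ ()) ∷ []) ∷ ((λ ()) ∷ []) ∷ [] ∷ [])
    (((λ ()) ∷ (λ ()) ∷ []) ∷ ((λ ()) ∷ []) ∷ [] ∷ [])
    (λ { zero → inj₁ refl ; (suc zero) → inj₁ refl })
    (inj₂ refl)

  spineSquare : ∀ {i y} → i < d → ChordOf i y → (s₀ s₁ q x : Fin n) →
    name s₀ ≡ spine i → name s₁ ≡ spine (suc i) → name q ≡ rung (suc i) → name x ≡ y → Cycle G 3
  spineSquare {i} {y} i<d c s₀ s₁ q x n₀ n₁ nq nx = polygon
    (a i ∷ a (suc i) ∷ a (2 + i) ∷ b (2 + i) ∷ [])
    (spine i ∷ spine (suc i) ∷ rung (suc i) ∷ y ∷ [])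
    (s₀ ∷ s₁ ∷ q ∷ x ∷ [])
    (λ { zero → n₀ ; (suc zero) → n₁ ; (suc (suc zero)) → nq ; (suc (suc (suc zero))) → nx })
    (a-in-range (≤-trans (n≤1+n i) (≤-trans i<d (n≤1+n d))) ∷ a-in-range (≤-trans i<d (n≤1+n d)) ∷
     a-in-range (s≤s i<d) ∷ b-in-range (s≤s i<d) ∷ [])
    (((λ ()) ∷ (λ ()) ∷ (λ ()) ∷ []) ∷ ((λ ()) ∷ (λ ()) ∷ []) ∷ ((λ ()) ∷ []) ∷ [] ∷ [])
    (((λ ()) ∷ (λ ()) ∷ chord-distinct c (λ ()) ∷ []) ∷ ((λ ()) ∷ chord-distinct c (λ ()) ∷ []) ∷
     (chord-distinct c (λ ()) ∷ []) ∷ [] ∷ [])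
    (λ { zero → inj₁ refl ; (suc zero) → inj₁ refl ; (suc (suc zero)) → inj₁ refl })
    (inj₂ (chord-endpoints c))

  diagSquare : ∀ {i y} → i < d → ChordOf i y → (δ₀ q δ₁ x : Fin n) →
    name δ₀ ≡ diag i → name q ≡ rung i → name δ₁ ≡ diag (suc i) → name x ≡ y → Cycle G 3
  diagSquare {i} {y} i<d c δ₀ q δ₁ x n₀ nq n₁ nx = polygon
    (a i ∷ b (suc i) ∷ a (suc i) ∷ b (2 + i) ∷ [])
    (diag i ∷ rung i ∷ diag (suc i) ∷ y ∷ [])
    (δ₀ ∷ q ∷ δ₁ ∷ x ∷ [])
    (λ { zero → n₀ ; (suc zero) → nq ; (suc (suc zero)) → n₁ ; (suc (suc (suc zero))) → nx })
    (a-in-range (≤-trans (n≤1+n i) (≤-trans i<d (n≤1+n d))) ∷ b-in-range (≤-trans i<d (n≤1+n d)) ∷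
     a-in-range (≤-trans i<d (n≤1+n d)) ∷ b-in-range (s≤s i<d) ∷ [])
    (((λ ()) ∷ (λ ()) ∷ (λ ()) ∷ []) ∷ ((λ ()) ∷ (λ ()) ∷ []) ∷ ((λ ()) ∷ []) ∷ [] ∷ [])
    (((λ ()) ∷ (λ ()) ∷ chord-distinct c (λ ()) ∷ []) ∷ ((λ ()) ∷ chord-distinct c (λ ()) ∷ []) ∷
     (chord-distinct c (λ ()) ∷ []) ∷ [] ∷ [])
    (λ { zero → inj₁ refl ; (suc zero) → inj₂ refl ; (suc (suc zero)) → inj₁ refl })
    (inj₂ (chord-endpoints c))

  open BlockWeights r

  uBlocks vBlocks : ∀ k → Bits k
  uBlocks zero    = true ∷ true ∷ replicate r false
  uBlocks (suc k) = true ∷ true ∷ false ∷ false ∷ uBlocks k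
  vBlocks zero    = true ∷ false ∷ replicate r false
  vBlocks (suc k) = true ∷ false ∷ true ∷ false ∷ vBlocks k

  u v : Subset n
  u = false ∷ uBlocks d
  v = true ∷ vBlocks d

  bit-uBlocks : ∀ k t → bit (uBlocks k) t ≡ rungOrSpine (blockName k t)
  bit-uBlocks zero    0 = refl
  bit-uBlocks zero    1 = refl
  bit-uBlocks zero    (suc (suc t)) = bit-replicate r t
  bit-uBlocks (suc k) 0 = refl
  bit-uBlocks (suc k) 1 = refl
  bit-uBlocks (suc k) 2 = refl
  bit-uBlocks (suc k) 3 = refl
  bit-uBlocks (suc k) (suc (suc (suc (suc t)))) = trans (bit-uBlocks k t) (sym (rungOrSpine-shift (blockName k t)))

  bit-vBlocks : ∀ k t → bit (vBlocks k) t ≡ rungOrDiag (blockName k t)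
  bit-vBlocks zero    0 = refl
  bit-vBlocks zero    1 = refl
  bit-vBlocks zero    (suc (suc t)) = bit-replicate r t
  bit-vBlocks (suc k) 0 = refl
  bit-vBlocks (suc k) 1 = refl
  bit-vBlocks (suc k) 2 = refl
  bit-vBlocks (suc k) 3 = refl
  bit-vBlocks (suc k) (suc (suc (suc (suc t)))) = trans (bit-vBlocks k t) (sym (rungOrDiag-shift (blockName k t)))

  bit-u : ∀ t → bit u t ≡ rungOrSpine (nameAt t)
  bit-u zero    = refl
  bit-u (suc t) = bit-uBlocks d t

  bit-v : ∀ t → bit v t ≡ rungOrDiag (nameAt t)
  bit-v zero    = refl
  bit-v (suc t) = bit-vBlocks d t

  ∈u⇔ : ∀ {e} → e ∈ u ⇔ rungOrSpine (name e) ≡ true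
  ∈u⇔ {e} = mk⇔ (λ e∈u → trans (sym (bit-u (toℕ e))) (Equivalence.to ∈⇔bit e∈u))
                (λ isIn → Equivalence.from ∈⇔bit (trans (bit-u (toℕ e)) isIn))

  ∈v⇔ : ∀ {e} → e ∈ v ⇔ rungOrDiag (name e) ≡ true
  ∈v⇔ {e} = mk⇔ (λ e∈v → trans (sym (bit-v (toℕ e))) (Equivalence.to ∈⇔bit e∈v))
                (λ isIn → Equivalence.from ∈⇔bit (trans (bit-v (toℕ e)) isIn))

  class-independent : ∀ o {K W} → K pad ≡ false → HeadInjective o K →
                      (∀ {e} → e ∈ W → K (name e) ≡ true) → Independent G W
  class-independent o noPad injective inK C circuit C⊆W with circuit⇒cycle G circuit
  ... | _ , c , es∈C = Forest.no-cycle-in-class o noPad injective c λ i → inK (C⊆W (es∈C i))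

  u-independent : Independent G u
  u-independent = class-independent orientation₀ refl rungOrSpine-heads (Equivalence.to ∈u⇔)

  v-independent : Independent G v
  v-independent = class-independent orientation₁ refl rungOrDiag-heads (Equivalence.to ∈v⇔)

  u-basis : IsBasis G u
  u-basis = closing-cycles⇒basis G u-independent λ e e∉u → closes e∉u (name e) refl (name-valid e)
    where
    edgeOf∈u : ∀ x → Valid x → rungOrSpine x ≡ true → edgeOf x ∈ u
    edgeOf∈u x valid isIn =
      Equivalence.from ∈u⇔ (trans (cong rungOrSpine (name-edgeOf x valid (class-not-pad rungOrSpine refl isIn))) isIn)
    closes-chord : ∀ {i y e} → i < d → ChordOf i y → name e ≡ y →
             ∃₂ λ k (c : Cycle G k) → ∀ j → Cycle.es c j ≡ e ⊎ Cycle.es c j ∈ u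
    closes-chord {i} {e = e} i<d c named =
      3 , spineSquare i<d c (edgeOf (spine i)) (edgeOf (spine (suc i))) (edgeOf (rung (suc i))) e
            (name-edgeOf (spine i) i≤d λ ()) (name-edgeOf (spine (suc i)) i<d λ ())
            (name-edgeOf (rung (suc i)) i<d λ ()) named ,
      λ { zero → inj₂ (edgeOf∈u (spine i) i≤d refl) ; (suc zero) → inj₂ (edgeOf∈u (spine (suc i)) i<d refl)
        ; (suc (suc zero)) → inj₂ (edgeOf∈u (rung (suc i)) i<d refl) ; (suc (suc (suc zero))) → inj₁ refl }
      where i≤d = ≤-trans (n≤1+n i) i<d
    closes : ∀ {e} → e ∉ u → ∀ x → name e ≡ x → Valid x →
             ∃₂ λ k (c : Cycle G k) → ∀ j → Cycle.es c j ≡ e ⊎ Cycle.es c j ∈ u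
    closes e∉u (rung i)  named _ = ⊥-elim (e∉u (Equivalence.from ∈u⇔ (cong rungOrSpine named)))
    closes e∉u (spine i) named _ = ⊥-elim (e∉u (Equivalence.from ∈u⇔ (cong rungOrSpine named)))
    closes {e} _ (diag i) named i≤d =
      2 , triangle i≤d (edgeOf (spine i)) (edgeOf (rung i)) e
            (name-edgeOf (spine i) i≤d λ ()) (name-edgeOf (rung i) i≤d λ ()) named ,
      λ { zero → inj₂ (edgeOf∈u (spine i) i≤d refl) ; (suc zero) → inj₂ (edgeOf∈u (rung i) i≤d refl)
        ; (suc (suc zero)) → inj₁ refl }
    closes _ (chord i) named i<d = closes-chord i<d (chord i) named
    closes _ pad       named _   = closes-chord (s≤s z≤n) pad named

  v-basis : IsBasis G v
  v-basis = closing-cycles⇒basis G v-independent λ e e∉v → closes e∉v (name e) refl (name-valid e)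
    where
    edgeOf∈v : ∀ x → Valid x → rungOrDiag x ≡ true → edgeOf x ∈ v
    edgeOf∈v x valid isIn =
      Equivalence.from ∈v⇔ (trans (cong rungOrDiag (name-edgeOf x valid (class-not-pad rungOrDiag refl isIn))) isIn)
    closes-chord : ∀ {i y e} → i < d → ChordOf i y → name e ≡ y →
             ∃₂ λ k (c : Cycle G k) → ∀ j → Cycle.es c j ≡ e ⊎ Cycle.es c j ∈ v
    closes-chord {i} {e = e} i<d c named =
      3 , diagSquare i<d c (edgeOf (diag i)) (edgeOf (rung i)) (edgeOf (diag (suc i))) e
            (name-edgeOf (diag i) i≤d λ ()) (name-edgeOf (rung i) i≤d λ ())
            (name-edgeOf (diag (suc i)) i<d λ ()) named ,
      λ { zero → inj₂ (edgeOf∈v (diag i) i≤d refl) ; (suc zero) → inj₂ (edgeOf∈v (rung i) i≤d refl)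
        ; (suc (suc zero)) → inj₂ (edgeOf∈v (diag (suc i)) i<d refl) ; (suc (suc (suc zero))) → inj₁ refl }
      where i≤d = ≤-trans (n≤1+n i) i<d
    closes : ∀ {e} → e ∉ v → ∀ x → name e ≡ x → Valid x →
             ∃₂ λ k (c : Cycle G k) → ∀ j → Cycle.es c j ≡ e ⊎ Cycle.es c j ∈ v
    closes e∉v (rung i) named _ = ⊥-elim (e∉v (Equivalence.from ∈v⇔ (cong rungOrDiag named)))
    closes e∉v (diag i) named _ = ⊥-elim (e∉v (Equivalence.from ∈v⇔ (cong rungOrDiag named)))
    closes {e} _ (spine i) named i≤d =
      2 , triangle i≤d e (edgeOf (rung i)) (edgeOf (diag i))
            named (name-edgeOf (rung i) i≤d λ ()) (name-edgeOf (diag i) i≤d λ ()) ,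
      λ { zero → inj₁ refl ; (suc zero) → inj₂ (edgeOf∈v (rung i) i≤d refl)
        ; (suc (suc zero)) → inj₂ (edgeOf∈v (diag i) i≤d refl) }
    closes _ (chord i) named i<d = closes-chord i<d (chord i) named
    closes _ pad       named _   = closes-chord (s≤s z≤n) pad named

  no-cycle-above : ∀ o {K W e x} → K pad ≡ false → HeadInjective o K → name e ≡ x → Separated o x K →
    (∀ {f} → f ∈ W → priority x ≤ priority (name f) → K (name f) ≡ true) →
    ∀ {k} (c : Cycle G k) → ¬ (∀ j → AboveIn G O W e (Cycle.es c j))
  no-cycle-above o {K} {W} {e} noPad injective refl separated lift c above =
    Forest.no-cycle-through o noPad injective e separated c λ j → in-class (above j)
    where
    in-class : ∀ {f} → AboveIn G O W e f → f ≡ e ⊎ K (name f) ≡ true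
    in-class (inj₁ f≡e) = inj₁ f≡e
    in-class {f} (inj₂ (f∈W , e<f)) = inj₂ (lift f∈W (rank-<⇒priority-≤ {e} {f} e<f))

  u-nbc : ∀ D → IsBrokenCircuit G O D → ¬ D ⊆ u
  u-nbc = no-cycle-above⇒no-broken-circuit G O u-independent λ e e∉u → cases e∉u (name e) refl
    where
    in-u : ∀ {f} → f ∈ u → rungOrSpine (name f) ≡ true
    in-u = Equivalence.to ∈u⇔
    cases : ∀ {e} → e ∉ u → ∀ x → name e ≡ x → ∀ {k} (c : Cycle G k) → ¬ (∀ j → AboveIn G O u e (Cycle.es c j))
    cases e∉u (rung i)  named _ _ = e∉u (Equivalence.from ∈u⇔ (cong rungOrSpine named))
    cases e∉u (spine i) named _ _ = e∉u (Equivalence.from ∈u⇔ (cong rungOrSpine named))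
    -- no edge of u ranks above a diagonal, so the cycle would be a loop
    cases _ (diag i) named = no-cycle-above orientation₀ {K = λ _ → false} refl (λ _ _ ()) named (λ _ ())
      λ f∈u 3≤f → ⊥-elim (rungOrSpine-≱3 _ (in-u f∈u) 3≤f)
    cases _ (chord i) named = no-cycle-above orientation₀ refl spine-heads₀ named (chord-spine-separated (chord i))
      λ f∈u 1≤f → rungOrSpine-≥1⇒spine _ (in-u f∈u) 1≤f
    cases _ pad named = no-cycle-above orientation₀ refl spine-heads₀ named (chord-spine-separated pad)
      λ f∈u 1≤f → rungOrSpine-≥1⇒spine _ (in-u f∈u) 1≤f

  v-nbc : ∀ D → IsBrokenCircuit G O D → ¬ D ⊆ v
  v-nbc = no-cycle-above⇒no-broken-circuit G O v-independent λ e e∉v → cases e∉v (name e) refl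
    where
    in-v : ∀ {f} → f ∈ v → rungOrDiag (name f) ≡ true
    in-v = Equivalence.to ∈v⇔
    cases : ∀ {e} → e ∉ v → ∀ x → name e ≡ x → ∀ {k} (c : Cycle G k) → ¬ (∀ j → AboveIn G O v e (Cycle.es c j))
    cases e∉v (rung i) named _ _ = e∉v (Equivalence.from ∈v⇔ (cong rungOrDiag named))
    cases e∉v (diag i) named _ _ = e∉v (Equivalence.from ∈v⇔ (cong rungOrDiag named))
    cases _ (spine i) named = no-cycle-above orientation₁ refl diag-heads₁ named (spine-diag-separated i)
      λ f∈v 2≤f → rungOrDiag-≥1⇒diag _ (in-v f∈v) (<⇒≤ 2≤f)
    cases _ (chord i) named = no-cycle-above orientation₂ refl diag-heads₂ named (chord-diag-separated (chord i))
      λ f∈v 1≤f → rungOrDiag-≥1⇒diag _ (in-v f∈v) 1≤f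
    cases _ pad named = no-cycle-above orientation₂ refl diag-heads₂ named (chord-diag-separated pad)
      λ f∈v 1≤f → rungOrDiag-≥1⇒diag _ (in-v f∈v) 1≤f

  u-nbcBasis : IsNBCBasis G O u
  u-nbcBasis = u-basis , u-nbc

  v-nbcBasis : IsNBCBasis G O v
  v-nbcBasis = v-basis , v-nbc

  canonical : ∀ {e x} → name e ≡ x → x ≢ pad → e ≡ edgeOf x
  canonical {e} {x} named notPad =
    name-injective (trans named (sym (name-edgeOf x (subst Valid named (name-valid e)) notPad))) (notPad ∘ trans (sym named))

  class⊆ : ∀ {K W W′} → K pad ≡ false → (∀ {e} → e ∈ W → K (name e) ≡ true) →
           (∀ x → Valid x → K x ≡ true → edgeOf x ∈ W′) → W ⊆ W′
  class⊆ {K} {W′ = W′} noPad inK byName {e} e∈W =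
    subst (_∈ W′) (sym (canonical refl (class-not-pad K noPad (inK e∈W)))) (byName (name e) (name-valid e) (inK e∈W))

  rank-<-by-name : ∀ e f {x y} → name e ≡ x → name f ≡ y → priority x < priority y → edgeRank e < edgeRank f
  rank-<-by-name e f refl refl = rank-< {e} {f}

  in-by-bit : ∀ {w} x → Valid x → bit w (pos x) ≡ true → edgeOf x ∈ w
  in-by-bit {w} x valid set = Equivalence.from ∈⇔bit (trans (cong (bit w) (toℕ-edgeOf x valid)) set)

  no-spine-with-next-diag : ∀ {w} → IsNBCBasis G O w → ∀ {i} → i < d →
    edgeOf (spine i) ∈ w → edgeOf (diag (suc i)) ∈ w → ⊥
  no-spine-with-next-diag (_ , nbc) {i} i<d s∈w δ∈w = nbc-avoids-broken-cycle G O nbc c (suc (suc zero)) least others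
    where
    ns = name-edgeOf (spine i) (≤-trans (n≤1+n i) i<d) λ ()
    nδ = name-edgeOf (diag (suc i)) i<d λ ()
    nx = name-edgeOf (chord i) i<d λ ()
    c = chordTriangle i<d (edgeOf (spine i)) (edgeOf (diag (suc i))) (edgeOf (chord i)) ns nδ nx
    least : ∀ j → j ≢ suc (suc zero) → edgeRank (edgeOf (chord i)) < edgeRank (Cycle.es c j)
    least zero _ = rank-<-by-name (edgeOf (chord i)) (edgeOf (spine i)) nx ns (<ᵇ⇒< 1 2 _)
    least (suc zero) _ = rank-<-by-name (edgeOf (chord i)) (edgeOf (diag (suc i))) nx nδ (<ᵇ⇒< 1 3 _)
    least (suc (suc zero)) j≢2 = ⊥-elim (j≢2 refl)
    others : ∀ j → j ≢ suc (suc zero) → Cycle.es c j ∈ _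
    others zero _ = s∈w
    others (suc zero) _ = δ∈w
    others (suc (suc zero)) j≢2 = ⊥-elim (j≢2 refl)

  weights : Fin n → ℕ
  weights zero    = 1
  weights (suc t) = blockWeight d t

  module NBCBasis {q₀ : Bool} {ws : Bits d} (nbc : IsNBCBasis G O (q₀ ∷ ws)) where
    w : Subset n
    w = q₀ ∷ ws

    w-independent : Independent G w
    w-independent = proj₁ (proj₁ nbc)

    no-conflict : NoConflict d ws
    no-conflict i i<d s δ = no-spine-with-next-diag nbc i<d
      (in-by-bit (spine i) (≤-trans (n≤1+n i) i<d) s) (in-by-bit (diag (suc i)) i<d δ)

    module _ (saturated : Saturated d ws) where
      rung∈w : ∀ i → i ≤ d → edgeOf (rung i) ∈ w
      rung∈w i i≤d with m≤n⇒m<n∨m≡n i≤d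
      ... | inj₁ i<d  = in-by-bit (rung i) i≤d (proj₁ (proj₁ saturated i i<d))
      ... | inj₂ refl = in-by-bit (rung d) i≤d (proj₂ saturated)

      spine-or-next-diag : ∀ i → i < d → edgeOf (spine i) ∈ w ⊎ edgeOf (diag (suc i)) ∈ w
      spine-or-next-diag i i<d =
        Sum.map (in-by-bit (spine i) (≤-trans (n≤1+n i) i<d)) (in-by-bit (diag (suc i)) i<d) (proj₂ (proj₁ saturated i i<d))

      not-spine-and-diag : ∀ i → i ≤ d → edgeOf (spine i) ∈ w → edgeOf (diag i) ∈ w → ⊥
      not-spine-and-diag i i≤d s∈w δ∈w = independent⇒no-cycle G w-independent
        (triangle i≤d _ _ _ (name-edgeOf (spine i) i≤d λ ()) (name-edgeOf (rung i) i≤d λ ())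
                            (name-edgeOf (diag i) i≤d λ ()))
        λ { zero → s∈w ; (suc zero) → rung∈w i i≤d ; (suc (suc zero)) → δ∈w }

      diags∈w : edgeOf (diag 0) ∈ w → ∀ i → i ≤ d → edgeOf (diag i) ∈ w
      diags∈w δ₀∈w zero    _   = δ₀∈w
      diags∈w δ₀∈w (suc i) i<d with spine-or-next-diag i i<d
      ... | inj₁ s∈w = ⊥-elim (not-spine-and-diag i (<⇒≤ i<d) s∈w (diags∈w δ₀∈w i (<⇒≤ i<d)))
      ... | inj₂ δ∈w = δ∈w

      spines∈w : edgeOf (spine d) ∈ w → ∀ k i → i + k ≡ d → edgeOf (spine i) ∈ w
      spines∈w s_d∈w zero    i i+0≡d = subst (λ j → edgeOf (spine j) ∈ w) (trans (sym i+0≡d) (+-identityʳ i)) s_d∈w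
      spines∈w s_d∈w (suc k) i i+k≡d = by-next (subst (i <_) i+k≡d (m<m+n i (s≤s z≤n)))
        where
        by-next : i < d → edgeOf (spine i) ∈ w
        by-next i<d with spine-or-next-diag i i<d
        ... | inj₁ s∈w = s∈w
        ... | inj₂ δ∈w =
          ⊥-elim (not-spine-and-diag (suc i) i<d (spines∈w s_d∈w k (suc i) (trans (sym (+-suc i k)) i+k≡d)) δ∈w)

      v⊆w : edgeOf (diag 0) ∈ w → v ⊆ w
      v⊆w δ₀∈w = class⊆ {K = rungOrDiag} refl (Equivalence.to ∈v⇔) λ
        { (rung i) i≤d _ → rung∈w i i≤d
        ; (diag i) i≤d _ → diags∈w δ₀∈w i i≤d }

      u⊆w : edgeOf (spine d) ∈ w → u ⊆ w
      u⊆w s_d∈w = class⊆ {K = rungOrSpine} refl (Equivalence.to ∈u⇔) λ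
        { (rung i)  i≤d _ → rung∈w i i≤d
        ; (spine i) i≤d _ → spines∈w s_d∈w (d ∸ i) i (m+[n∸m]≡n i≤d) }

  heavy⇒u-or-v : ∀ w → IsNBCBasis G O w → d * 6 + 5 ≤ dotℕ weights w → w ≡ u ⊎ w ≡ v
  heavy⇒u-or-v (true ∷ ws) nbc heavy =
    inj₂ (proj₂ v-basis _ (v⊆w saturated (in-by-bit (diag 0) z≤n refl)) w-independent)
    where
    open NBCBasis nbc
    saturated = weight-≥⇒saturated d ws no-conflict
                  (≤-pred (subst (_≤ suc (dotℕ (blockWeight d) ws)) (+-suc (d * 6) 4) heavy))
  heavy⇒u-or-v (false ∷ ws) nbc heavy = inj₁ (proj₂ u-basis _ (u⊆w saturated s_d∈w) w-independent)
    where
    open NBCBasis nbc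
    saturated = weight-≥⇒saturated d ws no-conflict (≤-trans (+-monoʳ-≤ (d * 6) (n≤1+n 4)) heavy)
    s_d∈w = in-by-bit (spine d) ≤-refl (weight-max⇒last d ws no-conflict heavy)

  u-weight : dotℕ weights u ≡ d * 6 + 5
  u-weight = blocks d
    where
    blocks : ∀ k → dotℕ (blockWeight k) (uBlocks k) ≡ k * 6 + 5
    blocks zero    = cong (5 +_) (dotℕ-zero (replicate r false))
    blocks (suc k) = cong (6 +_) (blocks k)

  v-weight : dotℕ weights v ≡ d * 6 + 5
  v-weight = trans (cong suc (blocks d)) (sym (+-suc (d * 6) 4))
    where
    blocks : ∀ k → dotℕ (blockWeight k) (vBlocks k) ≡ k * 6 + 4
    blocks zero    = cong (4 +_) (dotℕ-zero (replicate r false))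
    blocks (suc k) = cong (6 +_) (blocks k)

  u-v-edge : IsEdgeOfHull (IsNBCBasis G O) u v
  u-v-edge = edgeOfHull-by-weights weights u-nbcBasis v-nbcBasis (λ ()) (trans u-weight (sym v-weight)) lighter
    where
    lighter : ∀ w → IsNBCBasis G O w → w ≢ u → w ≢ v → dotℕ weights w < dotℕ weights u
    lighter w nbc w≢u w≢v =
      ≰⇒> λ heavy → Sum.[ w≢u , w≢v ] (heavy⇒u-or-v w nbc (subst (_≤ dotℕ weights w) u-weight heavy))

  u-v-distance : hamming u v ≡ 2 + d * 2
  u-v-distance = cong suc (blocks d)
    where
    blocks : ∀ k → hamming (uBlocks k) (vBlocks k) ≡ suc (k * 2)
    blocks zero    = cong suc (hamming-self (replicate r false))
    blocks (suc k) = cong (2 +_) (blocks k)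

  n≤3·distance : r < 4 → n ≤ 3 * hamming u v
  n≤3·distance r<4 = subst (n ≤_) (cong (3 *_) (sym u-v-distance)) (size-≤-distance d r r<4)

Realisable : ℕ → Set
Realisable n = Σ ℕ λ m → Σ (Graph m n) λ G → Σ (Ordering n) λ O →
  Σ (Subset n) λ u → Σ (Subset n) λ v → IsEdgeOfHull (IsNBCBasis G O) u v × n ≤ 3 * hamming u v

realisable : ∀ q r → r < 4 → Realisable (3 + (suc q * 4 + r))
realisable q r r<4 = m , G , O , u , v , u-v-edge , n≤3·distance r<4
  where open Construction q r

size-decomposition : ∀ n → 7 ≤ n → 3 + (suc ((n ∸ 7) / 4) * 4 + (n ∸ 7) % 4) ≡ n
size-decomposition n 7≤n = begin
  7 + ((n ∸ 7) / 4 * 4 + (n ∸ 7) % 4) ≡⟨ cong (7 +_) (+-comm ((n ∸ 7) / 4 * 4) ((n ∸ 7) % 4)) ⟩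
  7 + ((n ∸ 7) % 4 + (n ∸ 7) / 4 * 4) ≡⟨ cong (7 +_) (m≡m%n+[m/n]*n (n ∸ 7) 4) ⟨
  7 + (n ∸ 7)                         ≡⟨ m+[n∸m]≡n 7≤n ⟩
  n                                   ∎
  where open ≡-Reasoning

theorem1p11 : Σ ℕ λ K → Σ ℕ λ N → ∀ (n : ℕ) → N ≤ n →
    Σ ℕ λ m → Σ (Graph m n) λ G → Σ (Ordering n) λ O →
      Σ (Subset n) λ u → Σ (Subset n) λ v →
        IsEdgeOfHull (IsNBCBasis G O) u v × n ≤ suc K * hamming u v
theorem1p11 = 2 , 7 , λ n 7≤n →
  subst Realisable (size-decomposition n 7≤n) (realisable ((n ∸ 7) / 4) ((n ∸ 7) % 4) (m%n<n (n ∸ 7) 4))
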